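{- Let $q$ be a prime power and $s,t$ positive integers with $s\le t$. If there exists a linear OA$(s,t,q)$, then there exists a linear AOA$(s,t,t,q)$ and a linear AOA$(t-s,t,t,q)$.
   Context: An orthogonal array OA$(t,k,v)$ is a $v^t\times k$ array with entries from a set $X$ of size $v$ such that the restriction to any $t$ columns contains every $t$-tuple of $X^t$ exactly once. An OA$(t,k,q)$ over $\mathbb{F}_q$ is linear if its set of rows is a $t$-dimensional subspace of $\mathbb{F}_q^k$. An AOA$(s,t,k,v)$ is a $v^t\times (k+1)$ array $A$ such that: (1) the first $k$ columns form an OA$(t,k,v)$ on a set $X$ with $|X|=v$; (2) the last column has symbols from a set $Y$ with $|Y|=v^{t-s}$; (3) any $s$ of the first $k$ columns together with the last column contain every $(s+1)$-tuple of $X^s\times Y$ exactly once. A linear AOA$(s,t,k,q)$ is an AOA$(s,t,k,q)$ with $X=\mathbb{F}_q$, $Y=\mathbb{F}_q^{t-s}$, whose set of rows, each regarded as a vector of $\mathbb{F}_q^{k+t-s}$ (first $k$ entries followed by the $t-s$ coordinates of the last entry), is a $t$-dimensional $\mathbb{F}_q$-subspace. -}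

module Defs where

open import Level using (Level; _⊔_; suc)
open import Algebra.Bundles using (CommutativeRing)
open import Data.Nat using (ℕ; _∸_)
open import Data.Fin using (Fin)
import Data.Fin as Fin
open import Data.Product using (Σ; _×_; _,_)
open import Data.Sum using (_⊎_)
open import Function.Definitions using (Injective)
open import Function.Bundles using (Bijection)
open import Relation.Nullary using (¬_)
open import Relation.Binary.PropositionalEquality using (_≡_)
import Relation.Binary.PropositionalEquality as ≡

record Field (c ℓ : Level) : Set (suc (c ⊔ ℓ)) where
  field
    commRing : CommutativeRing c ℓ
  open CommutativeRing commRing public
  field
    0≉1     : ¬ (0# ≈ 1#)
    inverse : ∀ x → ¬ (x ≈ 0#) → Σ Carrier λ y → (x * y) ≈ 1#

-- A finite field with exactly q elements (F_q); such a field exists iff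
-- q is a prime power, and it is unique up to isomorphism.
record FiniteField (q : ℕ) (c ℓ : Level) : Set (suc (c ⊔ ℓ)) where
  field
    field′ : Field c ℓ
  open Field field′ public
  field
    card : Bijection setoid (≡.setoid (Fin q))

module _ {q : ℕ} {c ℓ : Level} (F : FiniteField q c ℓ) where
  open FiniteField F

  Vec : ℕ → Set c
  Vec n = Fin n → Carrier

  _≈ᵥ_ : ∀ {n} → Vec n → Vec n → Set ℓ
  u ≈ᵥ v = ∀ i → u i ≈ v i

  Σᶠ : ∀ n → (Fin n → Carrier) → Carrier
  Σᶠ ℕ.zero    f = 0#
  Σᶠ (ℕ.suc n) f = f Fin.zero + Σᶠ n (λ i → f (Fin.suc i))

  _·_ : ∀ {t m} → Vec t → (Fin t → Fin m → Carrier) → Vec m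
  _·_ {t} x M j = Σᶠ t (λ i → x i * M i j)

  ∃!ᵥ : ∀ t → (Vec t → Set ℓ) → Set (c ⊔ ℓ)
  ∃!ᵥ t P = Σ (Vec t) λ x → P x × (∀ x′ → P x′ → x′ ≈ᵥ x)

  -- A linear OA(t,k,q) over F, given by a t × k generator matrix G: the array
  -- has rows x·G indexed by x ∈ F^t (q^t rows); its set of rows is the
  -- row space of G.  OA property: for every choice c of t distinct columns
  -- and every t-tuple y, exactly one row agrees with y on those columns.
  -- (This forces the row space to be t-dimensional with the q^t rows distinct.)
  IsLinearOA : ∀ t k → (Fin t → Fin k → Carrier) → Set (c ⊔ ℓ)
  IsLinearOA t k G =
    (col : Fin t → Fin k) → Injective _≡_ _≡_ col →
    (y : Vec t) → ∃!ᵥ t (λ x → ∀ i → (x · G) (col i) ≈ y i)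

  LinearOA : ℕ → ℕ → Set (c ⊔ ℓ)
  LinearOA t k = Σ (Fin t → Fin k → Carrier) (IsLinearOA t k)

  -- A linear AOA(s,t,k,q) over F, given by a generator matrix [G | H] with
  -- G of size t × k (first k columns) and H of size t × (t-s) (the last
  -- column, with symbols in Y = F^(t-s)).
  IsLinearAOA : ∀ s t k → (Fin t → Fin k → Carrier) → (Fin t → Fin (t ∸ s) → Carrier) → Set (c ⊔ ℓ)
  IsLinearAOA s t k G H =
    IsLinearOA t k G
    ×
    ((col : Fin s → Fin k) → Injective _≡_ _≡_ col →
     (y : Vec s) (z : Vec (t ∸ s)) →
     ∃!ᵥ t (λ x → (∀ i → (x · G) (col i) ≈ y i) × ((x · H) ≈ᵥ z)))

  LinearAOA : ℕ → ℕ → ℕ → Set (c ⊔ ℓ)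
  LinearAOA s t k =
    Σ (Fin t → Fin k → Carrier) λ G →
    Σ (Fin t → Fin (t ∸ s) → Carrier) λ H → IsLinearAOA s t k G H

-- Write t = s + r and let A be the s × t generator matrix of the linear OA, so that every s × s
-- column minor of A is nonsingular.  A generator matrix [G | H] is a linear AOA(s,t,t) as soon as G
-- is nonsingular and, for every choice of s columns of G, those columns together with H form a
-- nonsingular t × t matrix.
--
-- AOA(s,t,t): stack A on top of [0 | I] to get G, and take H = [0 ; I].  Then G is block upper
-- triangular with diagonal blocks the leading s × s minor of A and I, while s chosen columns of G
-- next to H form a block lower triangular matrix with diagonal blocks an s × s minor of A and I.
--
-- AOA(t-s,t,t): take G = I and H = Aᵀ.  After permuting the rows so that the r chosen columns of
-- I come first (an injection Fin r → Fin t extends to a permutation), [I | Aᵀ] restricted to them is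
-- block upper triangular with diagonal blocks I and the transpose of the s × s minor of A on the
-- remaining columns; the transpose of a nonsingular matrix is nonsingular.

module Submission where

open import Defs hiding (_·_)
import Defs
open import Level using (Level; _⊔_)
open import Data.Nat as ℕ using (ℕ; zero; suc; _≤_; _∸_)
import Data.Nat.Properties as ℕₚ
open import Data.Fin using (Fin; zero; suc; _↑ˡ_; _↑ʳ_; splitAt; punchIn; punchOut)
open import Data.Fin.Properties
  using (_≟_; any?; injective⇒≤; punchOut-injective; punchIn-punchOut; join-splitAt;
         splitAt-↑ˡ; splitAt-↑ʳ; ↑ˡ-injective; ↑ʳ-injective; suc-injective)
open import Data.Fin.Permutation using (Permutation; _⟨$⟩ʳ_; _⟨$⟩ˡ_; inverseˡ; inverseʳ; insert; cast-id)
open import Data.Vec.Functional using (Vector; _++_; take; drop; transpose)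
open import Data.Vec.Functional.Properties using (lookup-++ˡ; lookup-++ʳ)
open import Data.Product using (Σ; ∃; _×_; _,_; proj₁; proj₂)
open import Data.Sum using (inj₁; inj₂)
open import Data.Sum.Properties using ([,]-∘)
open import Function using (_∘_)
open import Function.Bundles using (Injection)
open import Function.Definitions using (Injective)
open import Function.Properties.Inverse using (Inverse⇒Injection)
open import Relation.Binary.PropositionalEquality as ≡ using (_≡_; _≢_; _≗_)
open import Relation.Nullary using (yes; no; contradiction)

private
  variable
    a : Level
    A : Set a
    m n k : ℕ

++-take-drop : ∀ m (xs : Vector A (m ℕ.+ n)) → take m xs ++ drop m xs ≗ xs
++-take-drop {n = n} m xs i = ≡.trans (≡.sym ([,]-∘ xs (splitAt m i))) (≡.cong xs (join-splitAt m n i))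

↑ˡ≢↑ʳ : ∀ (i : Fin m) (j : Fin n) → i ↑ˡ n ≢ m ↑ʳ j
↑ˡ≢↑ʳ {m} {n} i j e with ≡.trans (≡.sym (splitAt-↑ˡ m i n)) (≡.trans (≡.cong (splitAt m) e) (splitAt-↑ʳ m n j))
... | ()

injective⇒surjective : {f : Fin n → Fin n} → Injective _≡_ _≡_ f → ∀ y → ∃ λ x → f x ≡ y
injective⇒surjective {suc n} {f} f-inj y with any? (λ x → f x ≟ y)
... | yes hit = hit
... | no miss = contradiction (injective⇒≤ punchOut-f-injective) ℕₚ.1+n≰n
  where
  y≢f : ∀ x → y ≢ f x
  y≢f x e = miss (x , ≡.sym e)
  punchOut-f-injective : Injective _≡_ _≡_ (λ x → punchOut (y≢f x))
  punchOut-f-injective e = f-inj (punchOut-injective (y≢f _) (y≢f _) e)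

injection⇒permutation : ∀ m {k n} → m ℕ.+ k ≡ n → (f : Fin m → Fin n) → Injective _≡_ _≡_ f →
  Σ (Permutation (m ℕ.+ k) n) λ π → ∀ i → π ⟨$⟩ʳ (i ↑ˡ k) ≡ f i
injection⇒permutation zero m+k≡n f _ = cast-id m+k≡n , λ ()
injection⇒permutation (suc m) {k} ≡.refl f f-inj = insert zero (f zero) π , extends
  where
  f₀≢f : ∀ i → f zero ≢ f (suc i)
  f₀≢f i e with f-inj e
  ... | ()
  f-punchedOut : Fin m → Fin (m ℕ.+ k)
  f-punchedOut i = punchOut (f₀≢f i)
  rest : Σ (Permutation (m ℕ.+ k) (m ℕ.+ k)) λ π → ∀ i → π ⟨$⟩ʳ (i ↑ˡ k) ≡ f-punchedOut i
  rest = injection⇒permutation m ≡.refl f-punchedOut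
           (λ e → suc-injective (f-inj (punchOut-injective (f₀≢f _) (f₀≢f _) e)))
  π : Permutation (m ℕ.+ k) (m ℕ.+ k)
  π = proj₁ rest
  extends : ∀ i → insert zero (f zero) π ⟨$⟩ʳ (i ↑ˡ k) ≡ f i
  extends zero = ≡.refl
  extends (suc i) = ≡.trans (≡.cong (punchIn (f zero)) (proj₂ rest i)) (punchIn-punchOut (f₀≢f i))

module LinearAlgebra {q : ℕ} {c ℓ : Level} (F : FiniteField q c ℓ) where
  open FiniteField F hiding (zero)
  open import Algebra.Properties.Semiring.Sum semiring
    using (sum; sum-syntax; sum-cong-≋; sum-replicate-zero; ∑-comm; sum-permute; *-distribˡ-sum; *-distribʳ-sum)
  open import Algebra.Properties.Group +-group using (\\-leftDividesˡ; y≈x\\z)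
  open import Data.Vec.Functional.Relation.Binary.Equality.Setoid setoid
    using (_≋_; ≋-refl; ≋-sym; ≋-trans; ++⁺; ++⁻ˡ; ++⁻ʳ)
  open import Relation.Binary.Reasoning.Setoid setoid

  Mat : ℕ → ℕ → Set c
  Mat m n = Vector (Vector Carrier n) m

  infix 4 _≈ᴹ_
  _≈ᴹ_ : Mat m n → Mat m n → Set ℓ
  M ≈ᴹ N = ∀ i → M i ≋ N i

  infixl 7 _·_ _⊗_
  _·_ : Vector Carrier m → Mat m n → Vector Carrier n
  _·_ = Defs._·_ F

  _⊗_ : Mat m n → Mat n k → Mat m k
  (M ⊗ N) i = M i · N

  infixr 5 _∣_
  _∣_ : Mat m n → Mat m k → Mat m (n ℕ.+ k)
  (M ∣ N) i = M i ++ N i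

  columns : Mat m n → (Fin k → Fin n) → Mat m k
  columns M col i = M i ∘ col

  0ᴹ : Mat m n
  0ᴹ _ _ = 0#

  1ᴹ : Mat n n
  1ᴹ zero    zero    = 1#
  1ᴹ zero    (suc _) = 0#
  1ᴹ (suc _) zero    = 0#
  1ᴹ (suc i) (suc j) = 1ᴹ i j

  1ᴹ-sym : ∀ (i j : Fin n) → 1ᴹ i j ≡ 1ᴹ j i
  1ᴹ-sym zero    zero    = ≡.refl
  1ᴹ-sym zero    (suc _) = ≡.refl
  1ᴹ-sym (suc _) zero    = ≡.refl
  1ᴹ-sym (suc i) (suc j) = 1ᴹ-sym i j

  1ᴹ-diagonal : ∀ (i : Fin n) → 1ᴹ i i ≡ 1#
  1ᴹ-diagonal zero    = ≡.refl
  1ᴹ-diagonal (suc i) = 1ᴹ-diagonal i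

  1ᴹ-offDiagonal : ∀ {i j : Fin n} → i ≢ j → 1ᴹ i j ≡ 0#
  1ᴹ-offDiagonal {i = zero}  {zero}  i≢j = contradiction ≡.refl i≢j
  1ᴹ-offDiagonal {i = zero}  {suc _} _   = ≡.refl
  1ᴹ-offDiagonal {i = suc _} {zero}  _   = ≡.refl
  1ᴹ-offDiagonal {i = suc i} {suc j} i≢j = 1ᴹ-offDiagonal (i≢j ∘ ≡.cong suc)

  1ᴹ-reindex : {f : Fin m → Fin n} → Injective _≡_ _≡_ f → ∀ i j → 1ᴹ (f i) (f j) ≡ 1ᴹ i j
  1ᴹ-reindex {f = f} f-inj i j with i ≟ j
  ... | yes ≡.refl = ≡.trans (1ᴹ-diagonal (f i)) (≡.sym (1ᴹ-diagonal i))
  ... | no i≢j = ≡.trans (1ᴹ-offDiagonal (i≢j ∘ f-inj)) (≡.sym (1ᴹ-offDiagonal i≢j))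

  Σᶠ≡sum : ∀ n (f : Vector Carrier n) → Σᶠ F n f ≡ sum f
  Σᶠ≡sum zero    f = ≡.refl
  Σᶠ≡sum (suc n) f = ≡.cong (f zero +_) (Σᶠ≡sum n (f ∘ suc))

  Σᶠ-cong : ∀ {f g : Vector Carrier n} → f ≋ g → Σᶠ F n f ≈ Σᶠ F n g
  Σᶠ-cong {n} {f} {g} f≋g = begin
    Σᶠ F n f  ≡⟨ Σᶠ≡sum n f ⟩
    sum f     ≈⟨ sum-cong-≋ f≋g ⟩
    sum g     ≡⟨ Σᶠ≡sum n g ⟨
    Σᶠ F n g  ∎

  Σᶠ-++ : ∀ m (f : Vector Carrier (m ℕ.+ n)) → Σᶠ F (m ℕ.+ n) f ≈ Σᶠ F m (take m f) + Σᶠ F n (drop m f)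
  Σᶠ-++ zero    f = sym (+-identityˡ _)
  Σᶠ-++ (suc m) f = trans (+-congˡ (Σᶠ-++ m (f ∘ suc))) (sym (+-assoc _ _ _))

  ·-cong : ∀ {x x′ : Vector Carrier m} {M M′ : Mat m n} → x ≋ x′ → M ≈ᴹ M′ → x · M ≋ x′ · M′
  ·-cong x≋x′ M≈M′ j = Σᶠ-cong (λ i → *-cong (x≋x′ i) (M≈M′ i j))

  ·-zeroʳ : ∀ (x : Vector Carrier m) (j : Fin n) → (x · 0ᴹ) j ≈ 0#
  ·-zeroʳ {m} x j = begin
    Σᶠ F m (λ i → x i * 0#)  ≡⟨ Σᶠ≡sum m _ ⟩
    ∑[ i < m ] (x i * 0#)    ≈⟨ sum-cong-≋ (λ i → zeroʳ (x i)) ⟩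
    ∑[ i < m ] 0#            ≈⟨ sum-replicate-zero m ⟩
    0#                       ∎

  ·-identityʳ : ∀ (x : Vector Carrier n) → x · 1ᴹ ≋ x
  ·-identityʳ {suc n} x zero = begin
    x zero * 1# + (x ∘ suc · 0ᴹ {n = suc n}) zero  ≈⟨ +-cong (*-identityʳ (x zero)) (·-zeroʳ {n = suc n} (x ∘ suc) zero) ⟩
    x zero + 0#                        ≈⟨ +-identityʳ (x zero) ⟩
    x zero                             ∎
  ·-identityʳ {suc n} x (suc j) = begin
    x zero * 0# + (x ∘ suc · 1ᴹ) j  ≈⟨ +-cong (zeroʳ (x zero)) (·-identityʳ (x ∘ suc) j) ⟩
    0# + x (suc j)                  ≈⟨ +-identityˡ (x (suc j)) ⟩
    x (suc j)                       ∎

  ·-assoc : ∀ (x : Vector Carrier m) (M : Mat m n) (N : Mat n k) → (x · M) · N ≋ x · (M ⊗ N)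
  ·-assoc {m} {n} x M N j = begin
    Σᶠ F n (λ l → (x · M) l * N l j)                ≡⟨ Σᶠ≡sum n _ ⟩
    ∑[ l < n ] ((x · M) l * N l j)                   ≈⟨ sum-cong-≋ (λ l → *-congʳ (reflexive (Σᶠ≡sum m (λ i → x i * M i l)))) ⟩
    ∑[ l < n ] (∑[ i < m ] (x i * M i l) * N l j)    ≈⟨ sum-cong-≋ (λ l → *-distribʳ-sum (N l j) (λ i → x i * M i l)) ⟩
    ∑[ l < n ] ∑[ i < m ] (x i * M i l * N l j)      ≈⟨ ∑-comm (λ i l → x i * M i l * N l j) ⟨
    ∑[ i < m ] ∑[ l < n ] (x i * M i l * N l j)      ≈⟨ sum-cong-≋ (λ i → sum-cong-≋ (λ l → *-assoc (x i) (M i l) (N l j))) ⟩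
    ∑[ i < m ] ∑[ l < n ] (x i * (M i l * N l j))    ≈⟨ sum-cong-≋ (λ i → *-distribˡ-sum (x i) (λ l → M i l * N l j)) ⟨
    ∑[ i < m ] (x i * ∑[ l < n ] (M i l * N l j))    ≈⟨ sum-cong-≋ (λ i → *-congˡ (reflexive (Σᶠ≡sum n (λ l → M i l * N l j)))) ⟨
    ∑[ i < m ] (x i * (M ⊗ N) i j)                   ≡⟨ Σᶠ≡sum m _ ⟨
    (x · (M ⊗ N)) j                                  ∎

  ⊗-transpose : ∀ (M : Mat m n) (N : Mat n k) → transpose (M ⊗ N) ≈ᴹ transpose N ⊗ transpose M
  ⊗-transpose M N j i = Σᶠ-cong (λ l → *-comm (M i l) (N l j))

  ⊗-identityˡ : ∀ (M : Mat m n) → 1ᴹ ⊗ M ≈ᴹ M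
  ⊗-identityˡ M i j = begin
    (1ᴹ ⊗ M) i j                         ≈⟨ ⊗-transpose 1ᴹ M j i ⟩
    (transpose M j · transpose 1ᴹ) i     ≈⟨ ·-cong ≋-refl (λ l l′ → reflexive (1ᴹ-sym l′ l)) i ⟩
    (transpose M j · 1ᴹ) i               ≈⟨ ·-identityʳ (transpose M j) i ⟩
    M i j                                ∎

  ·-++ : ∀ (x : Vector Carrier (m ℕ.+ n)) (M : Mat m k) (N : Mat n k) j →
    (x · (M ++ N)) j ≈ (take m x · M) j + (drop m x · N) j
  ·-++ {m} x M N j = trans (Σᶠ-++ m _)
    (+-cong (Σᶠ-cong (λ i → *-congˡ (reflexive (≡.cong (λ row → row j) (lookup-++ˡ M N i)))))
            (Σᶠ-cong (λ i → *-congˡ (reflexive (≡.cong (λ row → row j) (lookup-++ʳ M N i))))))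

  ·-∣ : ∀ (x : Vector Carrier m) (M : Mat m n) (N : Mat m k) → x · (M ∣ N) ≗ (x · M) ++ (x · N)
  ·-∣ {n = n} x M N j with splitAt n j
  ... | inj₁ _ = ≡.refl
  ... | inj₂ _ = ≡.refl

  ·-block : ∀ (u : Vector Carrier m) (v : Vector Carrier n)
    {m′ n′} (P : Mat m m′) (Q : Mat m n′) (R : Mat n m′) (S : Mat n n′) →
    (u ++ v) · ((P ∣ Q) ++ (R ∣ S)) ≋ (λ i → (u · P) i + (v · R) i) ++ (λ j → (u · Q) j + (v · S) j)
  ·-block {m} u v {m′} P Q R S l = begin
    ((u ++ v) · ((P ∣ Q) ++ (R ∣ S))) l                              ≈⟨ ·-++ (u ++ v) (P ∣ Q) (R ∣ S) l ⟩
    (take m (u ++ v) · (P ∣ Q)) l + (drop m (u ++ v) · (R ∣ S)) l    ≈⟨ +-cong (·-cong {M = P ∣ Q} (λ i → reflexive (lookup-++ˡ u v i)) (λ _ → ≋-refl) l)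
                                                                                 (·-cong {M = R ∣ S} (λ i → reflexive (lookup-++ʳ u v i)) (λ _ → ≋-refl) l) ⟩
    (u · (P ∣ Q)) l + (v · (R ∣ S)) l                                ≡⟨ columnwise ⟩
    ((λ i → (u · P) i + (v · R) i) ++ (λ j → (u · Q) j + (v · S) j)) l ∎
    where
    columnwise : (u · (P ∣ Q)) l + (v · (R ∣ S)) l ≡ ((λ i → (u · P) i + (v · R) i) ++ (λ j → (u · Q) j + (v · S) j)) l
    columnwise with splitAt m′ l
    ... | inj₁ _ = ≡.refl
    ... | inj₂ _ = ≡.refl

  ·-permute : ∀ {m′} (π : Permutation m′ m) (x : Vector Carrier m) (M : Mat m n) →
    x · M ≋ (x ∘ (π ⟨$⟩ʳ_)) · (M ∘ (π ⟨$⟩ʳ_))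
  ·-permute {m} {m′ = m′} π x M j = begin
    (x · M) j                                      ≡⟨ Σᶠ≡sum m _ ⟩
    ∑[ i < m ] (x i * M i j)                       ≈⟨ sum-permute _ π ⟩
    ∑[ i < m′ ] (x (π ⟨$⟩ʳ i) * M (π ⟨$⟩ʳ i) j)     ≡⟨ Σᶠ≡sum m′ _ ⟨
    ((x ∘ (π ⟨$⟩ʳ_)) · (M ∘ (π ⟨$⟩ʳ_))) j          ∎

  Nonsingular : Mat m n → Set (c ⊔ ℓ)
  Nonsingular {m} M = ∀ y → ∃!ᵥ F m (λ x → x · M ≋ y)

  module _ {M : Mat m n} (M-ns : Nonsingular M) (y : Vector Carrier n) where

    solution : Vector Carrier m
    solution = proj₁ (M-ns y)

    solution-solves : solution · M ≋ y
    solution-solves = proj₁ (proj₂ (M-ns y))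

    solution-unique : ∀ x → x · M ≋ y → x ≋ solution
    solution-unique = proj₂ (proj₂ (M-ns y))

  Nonsingular-cong : ∀ {M M′ : Mat m n} → M ≈ᴹ M′ → Nonsingular M → Nonsingular M′
  Nonsingular-cong M≈M′ M-ns y =
    solution M-ns y
      , ≋-trans (·-cong ≋-refl (λ i → ≋-sym (M≈M′ i))) (solution-solves M-ns y)
      , λ x xM′≋y → solution-unique M-ns y x (≋-trans (·-cong ≋-refl M≈M′) xM′≋y)

  ·-cancelʳ : ∀ {M : Mat m n} → Nonsingular M → ∀ {x x′} → x · M ≋ x′ · M → x ≋ x′
  ·-cancelʳ {M = M} M-ns {x} {x′} xM≋x′M =
    ≋-trans (solution-unique M-ns _ x xM≋x′M) (≋-sym (solution-unique M-ns _ x′ ≋-refl))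

  Nonsingular-1ᴹ : Nonsingular (1ᴹ {n})
  Nonsingular-1ᴹ y = y , ·-identityʳ y , λ x x1≋y → ≋-trans (≋-sym (·-identityʳ x)) x1≋y

  ⊗-inverse-transpose : ∀ {P : Mat m n} {Q : Mat n m} → P ⊗ Q ≈ᴹ 1ᴹ → transpose Q ⊗ transpose P ≈ᴹ 1ᴹ
  ⊗-inverse-transpose {P = P} {Q} P⊗Q≈1 i j =
    trans (sym (⊗-transpose P Q i j)) (trans (P⊗Q≈1 j i) (reflexive (1ᴹ-sym j i)))

  -- The solutions of x · M ≋ 1ᴹ i form a left inverse N; cancellation makes it a right inverse
  -- too, and transposing both inverse laws shows that x · transpose M ≋ y is solved by y · transpose N.
  Nonsingular-transpose : ∀ {M : Mat m n} → Nonsingular M → Nonsingular (transpose M)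
  Nonsingular-transpose {m} {n} {M} M-ns y = y · transpose N , solves , unique
    where
    N : Mat n m
    N i = solution M-ns (1ᴹ i)
    N⊗M≈1 : N ⊗ M ≈ᴹ 1ᴹ
    N⊗M≈1 i = solution-solves M-ns (1ᴹ i)
    M⊗N≈1 : M ⊗ N ≈ᴹ 1ᴹ
    M⊗N≈1 j = ·-cancelʳ M-ns
      (≋-trans (·-assoc (M j) N M) (≋-trans (·-cong ≋-refl N⊗M≈1)
        (≋-trans (·-identityʳ (M j)) (≋-sym (⊗-identityˡ M j)))))
    solves : y · transpose N · transpose M ≋ y
    solves = ≋-trans (·-assoc y (transpose N) (transpose M))
      (≋-trans (·-cong ≋-refl (⊗-inverse-transpose {P = M} M⊗N≈1)) (·-identityʳ y))
    unique : ∀ x → x · transpose M ≋ y → x ≋ y · transpose N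
    unique x xMᵀ≋y = ≋-trans (≋-sym (·-identityʳ x))
      (≋-trans (·-cong ≋-refl (λ i → ≋-sym (⊗-inverse-transpose {P = N} N⊗M≈1 i)))
        (≋-trans (≋-sym (·-assoc x (transpose M) (transpose N))) (·-cong xMᵀ≋y (λ _ → ≋-refl))))

  Nonsingular-upperTriangular : ∀ {m₁ m₂ n₁ n₂} {P : Mat m₁ n₁} {Q : Mat m₁ n₂} {S : Mat m₂ n₂} →
    Nonsingular P → Nonsingular S → Nonsingular ((P ∣ Q) ++ (0ᴹ ∣ S))
  Nonsingular-upperTriangular {m₁} {m₂} {n₁} {n₂} {P} {Q} {S} P-ns S-ns y = u ++ v , solves , unique
    where
    B : Mat (m₁ ℕ.+ m₂) (n₁ ℕ.+ n₂)
    B = (P ∣ Q) ++ (0ᴹ ∣ S)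
    residual : Vector Carrier m₁ → Vector Carrier n₂
    residual u′ j = - (u′ · Q) j + drop n₁ y j
    u : Vector Carrier m₁
    u = solution P-ns (take n₁ y)
    v : Vector Carrier m₂
    v = solution S-ns (residual u)
    B-product : ∀ u′ v′ → (u′ ++ v′) · B ≋ (u′ · P) ++ (λ j → (u′ · Q) j + (v′ · S) j)
    B-product u′ v′ = ≋-trans (·-block u′ v′ P Q 0ᴹ S)
      (++⁺ _≈_ {m = n₁} (λ i → trans (+-congˡ (·-zeroʳ v′ i)) (+-identityʳ _)) ≋-refl)
    solves : (u ++ v) · B ≋ y
    solves = ≋-trans (B-product u v)
      (≋-trans (++⁺ _≈_ {m = n₁} (solution-solves P-ns _)
                 (λ j → trans (+-congˡ (solution-solves S-ns _ j)) (\\-leftDividesˡ _ _)))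
               (λ j → reflexive (++-take-drop n₁ y j)))
    unique : ∀ x → x · B ≋ y → x ≋ u ++ v
    unique x xB≋y = ≋-trans (λ i → reflexive (≡.sym (++-take-drop m₁ x i))) (++⁺ _≈_ {m = m₁} take≋u drop≋v)
      where
      blockwise : (take m₁ x · P) ++ (λ j → (take m₁ x · Q) j + (drop m₁ x · S) j) ≋ take n₁ y ++ drop n₁ y
      blockwise = ≋-trans (≋-sym (B-product (take m₁ x) (drop m₁ x)))
        (≋-trans (·-cong (λ i → reflexive (++-take-drop m₁ x i)) (λ _ → ≋-refl))
          (≋-trans xB≋y (λ j → reflexive (≡.sym (++-take-drop n₁ y j)))))
      take≋u : take m₁ x ≋ u
      take≋u = solution-unique P-ns _ (take m₁ x) (++⁻ˡ _≈_ _ _ blockwise)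
      drop≋v : drop m₁ x ≋ v
      drop≋v = solution-unique S-ns _ (drop m₁ x) λ j →
        trans (y≈x\\z _ _ _ (++⁻ʳ _≈_ _ _ blockwise j)) (+-congʳ (-‿cong (·-cong {M = Q} take≋u (λ _ → ≋-refl) j)))

  transpose-block : ∀ {m₁ m₂ n₁ n₂} (P : Mat m₁ n₁) (Q : Mat m₁ n₂) (R : Mat m₂ n₁) (S : Mat m₂ n₂) →
    transpose ((P ∣ Q) ++ (R ∣ S)) ≈ᴹ (transpose P ∣ transpose R) ++ (transpose Q ∣ transpose S)
  transpose-block {m₁} {n₁ = n₁} P Q R S i j with splitAt m₁ j in eqʳ | splitAt n₁ i in eqᶜ
  ... | inj₁ _ | inj₁ _ rewrite eqʳ | eqᶜ = refl
  ... | inj₁ _ | inj₂ _ rewrite eqʳ | eqᶜ = refl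
  ... | inj₂ _ | inj₁ _ rewrite eqʳ | eqᶜ = refl
  ... | inj₂ _ | inj₂ _ rewrite eqʳ | eqᶜ = refl

  Nonsingular-lowerTriangular : ∀ {m₁ m₂ n₁ n₂} {P : Mat m₁ n₁} {R : Mat m₂ n₁} {S : Mat m₂ n₂} →
    Nonsingular P → Nonsingular S → Nonsingular ((P ∣ 0ᴹ) ++ (R ∣ S))
  Nonsingular-lowerTriangular {P = P} {R} {S} P-ns S-ns = Nonsingular-transpose
    (Nonsingular-cong (λ i → ≋-sym (transpose-block P 0ᴹ R S i))
      (Nonsingular-upperTriangular (Nonsingular-transpose P-ns) (Nonsingular-transpose S-ns)))

  Nonsingular-permuteColumns : ∀ {M : Mat m n} → Nonsingular M →
    ∀ {col : Fin n → Fin n} → Injective _≡_ _≡_ col → Nonsingular (columns M col)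
  Nonsingular-permuteColumns {n = n} {M = M} M-ns {col} col-inj y =
    solution M-ns (y ∘ col⁻¹)
      , (λ i → trans (solution-solves M-ns _ (col i)) (reflexive (≡.cong y (col-inj (col∘col⁻¹ (col i))))))
      , λ x x·col≋y → solution-unique M-ns _ x λ k →
          trans (reflexive (≡.cong (x · M) (≡.sym (col∘col⁻¹ k)))) (x·col≋y (col⁻¹ k))
    where
    col⁻¹ : Fin n → Fin n
    col⁻¹ k = proj₁ (injective⇒surjective col-inj k)
    col∘col⁻¹ : ∀ k → col (col⁻¹ k) ≡ k
    col∘col⁻¹ k = proj₂ (injective⇒surjective col-inj k)

  Nonsingular-permuteRows : ∀ {m′} {M : Mat m n} (π : Permutation m′ m) →
    Nonsingular (M ∘ (π ⟨$⟩ʳ_)) → Nonsingular M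
  Nonsingular-permuteRows {M = M} π Mπ-ns y =
    x ∘ (π ⟨$⟩ˡ_)
      , ≋-trans (·-permute π (x ∘ (π ⟨$⟩ˡ_)) M)
          (≋-trans (·-cong {M = M ∘ (π ⟨$⟩ʳ_)} (λ _ → reflexive (≡.cong x (inverseˡ π))) (λ _ → ≋-refl))
            (solution-solves Mπ-ns y))
      , λ x′ x′M≋y a → trans (reflexive (≡.cong x′ (≡.sym (inverseʳ π))))
          (solution-unique Mπ-ns y (x′ ∘ (π ⟨$⟩ʳ_)) (≋-trans (≋-sym (·-permute π x′ M)) x′M≋y) (π ⟨$⟩ˡ a))
    where
    x : Vector Carrier _
    x = solution Mπ-ns y

  Nonsingular-∣ : ∀ {M : Mat m n} {N : Mat m k} → Nonsingular (M ∣ N) →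
    ∀ y z → ∃!ᵥ F m (λ x → x · M ≋ y × x · N ≋ z)
  Nonsingular-∣ {m} {n} {M = M} {N} M∣N-ns y z =
    x , (++⁻ˡ _≈_ _ _ blockwise , ++⁻ʳ _≈_ _ _ blockwise)
      , λ x′ (x′M≋y , x′N≋z) →
          solution-unique M∣N-ns _ x′ (≋-trans (λ j → reflexive (·-∣ x′ M N j)) (++⁺ _≈_ {m = n} x′M≋y x′N≋z))
    where
    x : Vector Carrier m
    x = solution M∣N-ns (y ++ z)
    blockwise : (x · M) ++ (x · N) ≋ y ++ z
    blockwise = ≋-trans (λ j → reflexive (≡.sym (·-∣ x M N j))) (solution-solves M∣N-ns _)

  mkLinearAOA : ∀ {s t k d} → d ≡ t ∸ s → (G : Mat t k) (H : Mat t d) → IsLinearOA F t k G →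
    (∀ (col : Fin s → Fin k) → Injective _≡_ _≡_ col → Nonsingular (columns G col ∣ H)) →
    LinearAOA F s t k
  mkLinearAOA ≡.refl G H G-OA G∣H-ns = G , H , G-OA , λ col col-inj → Nonsingular-∣ (G∣H-ns col col-inj)

  LinearOA⇒LinearAOA : ∀ {s r} (A : Mat s (s ℕ.+ r)) → IsLinearOA F s (s ℕ.+ r) A →
    LinearAOA F s (s ℕ.+ r) (s ℕ.+ r)
  LinearOA⇒LinearAOA {s} {r} A A-OA = mkLinearAOA (≡.sym (ℕₚ.m+n∸m≡n s r)) G H G-OA G∣H-nonsingular
    where
    E : Mat r (s ℕ.+ r)
    E = 0ᴹ {n = s} ∣ 1ᴹ
    G : Mat (s ℕ.+ r) (s ℕ.+ r)
    G = A ++ E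
    H : Mat (s ℕ.+ r) r
    H = 0ᴹ {m = s} ++ 1ᴹ
    G-blocks : (columns A (_↑ˡ r) ∣ columns A (s ↑ʳ_)) ++ E ≈ᴹ G
    G-blocks a with splitAt s a
    ... | inj₁ i = λ k → reflexive (++-take-drop s (A i) k)
    ... | inj₂ _ = ≋-refl
    G-nonsingular : Nonsingular G
    G-nonsingular = Nonsingular-cong G-blocks
      (Nonsingular-upperTriangular (A-OA (_↑ˡ r) (λ {i} {j} → ↑ˡ-injective r i j)) Nonsingular-1ᴹ)
    G-OA : IsLinearOA F (s ℕ.+ r) (s ℕ.+ r) G
    G-OA col col-inj = Nonsingular-permuteColumns G-nonsingular col-inj
    G∣H-blocks : ∀ (col : Fin s → Fin (s ℕ.+ r)) →
      (columns A col ∣ 0ᴹ) ++ (columns E col ∣ 1ᴹ) ≈ᴹ columns G col ∣ H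
    G∣H-blocks col a with splitAt s a
    ... | inj₁ _ = ≋-refl
    ... | inj₂ _ = ≋-refl
    G∣H-nonsingular : ∀ (col : Fin s → Fin (s ℕ.+ r)) → Injective _≡_ _≡_ col →
      Nonsingular (columns G col ∣ H)
    G∣H-nonsingular col col-inj =
      Nonsingular-cong (G∣H-blocks col) (Nonsingular-lowerTriangular (A-OA col col-inj) Nonsingular-1ᴹ)

  LinearOA⇒LinearAOA-complement : ∀ {s r} (A : Mat s (s ℕ.+ r)) → IsLinearOA F s (s ℕ.+ r) A →
    LinearAOA F r (s ℕ.+ r) (s ℕ.+ r)
  LinearOA⇒LinearAOA-complement {s} {r} A A-OA =
    mkLinearAOA (≡.sym (ℕₚ.m+n∸n≡m s r)) 1ᴹ (transpose A) 1ᴹ-OA 1ᴹ∣Aᵀ-nonsingular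
    where
    1ᴹ-OA : IsLinearOA F (s ℕ.+ r) (s ℕ.+ r) 1ᴹ
    1ᴹ-OA col col-inj = Nonsingular-permuteColumns Nonsingular-1ᴹ col-inj
    1ᴹ∣Aᵀ-nonsingular : ∀ (col : Fin r → Fin (s ℕ.+ r)) → Injective _≡_ _≡_ col →
      Nonsingular (columns 1ᴹ col ∣ transpose A)
    1ᴹ∣Aᵀ-nonsingular col col-inj = Nonsingular-permuteRows π
      (Nonsingular-cong blocks
        (Nonsingular-upperTriangular Nonsingular-1ᴹ (Nonsingular-transpose (A-OA τ τ-injective))))
      where
      extension : Σ (Permutation (r ℕ.+ s) (s ℕ.+ r)) λ π → ∀ i → π ⟨$⟩ʳ (i ↑ˡ s) ≡ col i
      extension = injection⇒permutation r (ℕₚ.+-comm r s) col col-inj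
      π : Permutation (r ℕ.+ s) (s ℕ.+ r)
      π = proj₁ extension
      π-injective : Injective _≡_ _≡_ (π ⟨$⟩ʳ_)
      π-injective = Injection.injective (Inverse⇒Injection π)
      τ : Fin s → Fin (s ℕ.+ r)
      τ l = π ⟨$⟩ʳ (r ↑ʳ l)
      τ-injective : Injective _≡_ _≡_ τ
      τ-injective e = ↑ʳ-injective r _ _ (π-injective e)
      τ≢col : ∀ l i → τ l ≢ col i
      τ≢col l i e = ↑ˡ≢↑ʳ i l (π-injective (≡.trans (proj₂ extension i) (≡.sym e)))
      blocks : (1ᴹ ∣ transpose (columns A col)) ++ (0ᴹ ∣ transpose (columns A τ))
               ≈ᴹ (columns 1ᴹ col ∣ transpose A) ∘ (π ⟨$⟩ʳ_)
      blocks b with splitAt r b | join-splitAt r s b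
      ... | inj₁ i | ≡.refl rewrite proj₂ extension i =
        ++⁺ _≈_ {m = r} (λ i′ → reflexive (≡.sym (1ᴹ-reindex col-inj i i′))) ≋-refl
      ... | inj₂ l | ≡.refl =
        ++⁺ _≈_ {m = r} (λ i′ → reflexive (≡.sym (1ᴹ-offDiagonal (τ≢col l i′)))) ≋-refl

open LinearAlgebra using (LinearOA⇒LinearAOA; LinearOA⇒LinearAOA-complement)

theorem3p4 : {c ℓ : Level} (q : ℕ) (F : FiniteField q c ℓ) (s t : ℕ) →
    1 ≤ s → s ≤ t →
    LinearOA F s t →
    LinearAOA F s t t × LinearAOA F (t ∸ s) t t
theorem3p4 q F s t _ s≤t (A , A-OA) with ℕₚ.m≤n⇒∃[o]m+o≡n s≤t
... | r , ≡.refl =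
  LinearOA⇒LinearAOA F A A-OA ,
  ≡.subst (λ s′ → LinearAOA F s′ (s ℕ.+ r) (s ℕ.+ r)) (≡.sym (ℕₚ.m+n∸m≡n s r))
    (LinearOA⇒LinearAOA-complement F A A-OA)
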